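{- Let $\mathcal{A}$ be a pca with a partial numbering $\gamma : \omega \to \mathcal{A}$, and let $X = \{\langle n, m, k\rangle \mid n,m,k \in \omega \wedge \gamma(n)\cdot\gamma(m) = \gamma(k)\}$. Then $\mathcal{A}$ embeds in $\mathcal{G}^X$, and hence in $\mathcal{G}$.
   Context: A pca is a set with a partial binary application containing distinct $\mathrm{s},\mathrm{k}$ with $\mathrm{k}ab = a$, $\mathrm{s}ab$ defined, and $\mathrm{s}abc \simeq (ac)(bc)$. A partial numbering of $\mathcal{A}$ is a surjective partial function $\gamma : \omega \rightharpoonup \mathcal{A}$. An embedding is an injective map $f$ such that whenever $ab$ is defined, $f(a)f(b)$ is defined and equals $f(ab)$. $\mathcal{G}$ is $\mathcal{P}(\omega)$ with application $A \cdot B = \{n \mid \exists u\, (\langle n,u\rangle \in A \wedge D_u \subseteq B)\}$, $D_u$ the finite set with canonical code $u$, $\langle\cdot,\cdot\rangle$ an effective bijective pairing (extended to triples). $\mathcal{G}^X$ is the least class of sets containing $X$ and all c.e. sets and closed under this application (equivalently, the sets enumeration-reducible to $X$). -}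

module Defs where

open import Data.Nat using (ℕ; zero; suc; _+_; _*_; _/_; _%_)
open import Data.Fin using (Fin)
open import Data.Vec using (Vec; []; _∷_; lookup)
open import Data.Product using (Σ; ∃; _×_; _,_)
open import Data.Empty using (⊥)
import Data.Unit.Polymorphic
open import Relation.Nullary using (¬_)
open import Relation.Binary.PropositionalEquality using (_≡_)

_⇔_ : Set → Set → Set
P ⇔ Q = (P → Q) × (Q → P)

-- Partial combinatory algebras.
-- Partial application is a functional ternary relation  App a b c  ("ab is
-- defined and equals c").

record PCA : Set₁ where
  field
    Carrier : Set
    App     : Carrier → Carrier → Carrier → Set
    App-functional : ∀ {a b c c'} → App a b c → App a b c' → c ≡ c'
    k s     : Carrier
    k≢s     : ¬ (k ≡ s)
    -- k a b = a   (in particular k a and k a b are defined)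
    k-ax    : ∀ a b → Σ Carrier λ x → App k a x × App x b a
    s-def   : ∀ a b → Σ Carrier λ x → Σ Carrier λ y → App s a x × App x b y
    -- s a b c ≃ (a c)(b c)  (Kleene equality)
    s-ax    : ∀ a b c d →
      (Σ Carrier λ x → Σ Carrier λ y → App s a x × App x b y × App y c d)
      ⇔ (Σ Carrier λ e → Σ Carrier λ f → App a c e × App b c f × App e f d)

-- Partial numberings: surjective partial functions ω ⇀ 𝒜, given as a
-- functional relation  Num n a  ("γ(n) is defined and equals a").

record PartialNumbering (𝒜 : PCA) : Set₁ where
  open PCA 𝒜
  field
    Num        : ℕ → Carrier → Set
    functional : ∀ {n a b} → Num n a → Num n b → a ≡ b
    surjective : ∀ a → Σ ℕ λ n → Num n a

tri : ℕ → ℕ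
tri zero    = zero
tri (suc n) = suc n + tri n

-- ⟨x , y⟩ = (x+y)(x+y+1)/2 + y, an effective bijection ℕ×ℕ → ℕ
⟪_∣_⟫ : ℕ → ℕ → ℕ
⟪ x ∣ y ⟫ = tri (x + y) + y

⟪_∣_∣_⟫ : ℕ → ℕ → ℕ → ℕ
⟪ x ∣ y ∣ z ⟫ = ⟪ x ∣ ⟪ y ∣ z ⟫ ⟫

bit : ℕ → ℕ → ℕ
bit u zero    = u % 2
bit u (suc i) = bit (u / 2) i

-- D u : the finite set with canonical code u  (i ∈ D u ⇔ bit i of u is 1)
D : ℕ → ℕ → Set
D u i = bit u i ≡ 1

Subset : Set₁
Subset = ℕ → Set

_≐_ : Subset → Subset → Set
A ≐ B = ∀ n → A n ⇔ B n

_·_ : Subset → Subset → Subset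
(A · B) n = Σ ℕ λ u → A ⟪ n ∣ u ⟫ × (∀ i → D u i → B i)

data PR : ℕ → Set where
  zer  : ∀ {n} → PR n
  succ : PR 1
  proj : ∀ {n} → Fin n → PR n
  comp : ∀ {m n} → PR m → Vec (PR n) m → PR n
  prec : ∀ {n} → PR n → PR (suc (suc n)) → PR (suc n)

mutual
  eval : ∀ {n} → PR n → Vec ℕ n → ℕ
  eval zer         xs            = 0
  eval succ        (x ∷ [])      = suc x
  eval (proj i)    xs            = lookup xs i
  eval (comp f gs) xs            = eval f (evalAll gs xs)
  eval (prec g h)  (zero  ∷ xs)  = eval g xs
  eval (prec g h)  (suc y ∷ xs)  = eval h (y ∷ eval (prec g h) (y ∷ xs) ∷ xs)

  evalAll : ∀ {m n} → Vec (PR n) m → Vec ℕ n → Vec ℕ m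
  evalAll []       xs = []
  evalAll (g ∷ gs) xs = eval g xs ∷ evalAll gs xs

-- S is c.e. : S = { n | ∃ m. p(n,m) = 0 } for a primitive recursive p
-- (Kleene normal form definition of c.e.)
IsCE : Subset → Set
IsCE S = Σ (PR 2) λ p → ∀ n → S n ⇔ (Σ ℕ λ m → eval p (n ∷ m ∷ []) ≡ 0)

-- 𝒢^X : the least class containing X and all c.e. sets, closed under
-- graph-model application (closed under extensional equality of sets).

data InG^ (X : Subset) : Subset → Set₁ where
  base : ∀ {S} → S ≐ X → InG^ X S
  ce   : ∀ {S} → IsCE S → InG^ X S
  app  : ∀ {A B S} → InG^ X A → InG^ X B → S ≐ (A · B) → InG^ X S

record EmbeddingInto (𝒜 : PCA) (Cls : Subset → Set₁) : Set₁ where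
  open PCA 𝒜
  field
    f         : Carrier → Subset
    injective : ∀ {a b} → f a ≐ f b → a ≡ b
    hom       : ∀ {a b c} → App a b c → (f a · f b) ≐ f c
    inClass   : ∀ a → Cls (f a)

graphSet : (𝒜 : PCA) → PartialNumbering 𝒜 → Subset
graphSet 𝒜 γ x =
  Σ ℕ λ n → Σ ℕ λ m → Σ ℕ λ k → (x ≡ ⟪ n ∣ m ∣ k ⟫) ×
    (Σ Carrier λ a → Σ Carrier λ b → Σ Carrier λ c →
       Num n a × Num m b × Num k c × App a b c)
  where open PCA 𝒜
        open PartialNumbering γ

-- no restriction on the image (embedding into 𝒢 itself)
AnySet : Subset → Set₁
AnySet _ = Data.Unit.Polymorphic.⊤

-- The embedding sends c to a set ⟦ c ⟧ of codes built from numbers of elements: tags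
-- ⟨⟨t,p⟩,1⟩ with γ t = c, and steps ⟨x, 2^e⟩ where e is a tag of some b and x ∈ ⟦ c·b ⟧.
-- As D_{2^e} = {e}, the steps of ⟦ c ⟧ are exactly what graph application needs, so
-- ⟦ c ⟧ · ⟦ b ⟧ = ⟦ c·b ⟧, and the tags make ⟦_⟧ injective. Membership in ⟦ c ⟧ is witnessed
-- by a finite chain of steps ending in a tag, and each link is an instance of X (for a tag,
-- γ t = γ n is checked as k·γt = γj, γj·k = γn). Hence ⟦ c ⟧ = E · X, where E is the c.e. set of
-- ⟨y,u⟩ such that a primitive recursive verifier accepts y ∈ ⟦ c ⟧ from facts in D_u.

module Submission where

open import Defs
open import Data.Nat using (ℕ; zero; suc; s≤s⁻¹; _≤?_; ≤′-refl; ≤′-step; _+_; _*_; _∸_; _^_; _≤_; _<_; _≤′_; z≤n; s≤s; pred; _/_; _%_; _≟_; ∣_-_∣)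
open import Data.Nat.Properties
open import Data.Nat.DivMod
open import Data.Nat.Divisibility using (divides-refl)
open import Data.Nat.GeneralisedArithmetic using (fold; iterate; iterate-is-fold)
open import Data.Fin using (Fin) renaming (zero to fzero; suc to fsuc)
open import Data.Vec using (Vec; []; _∷_; head; tail; lookup)
open import Data.Product using (Σ-syntax; _×_; _,_; proj₁; proj₂)
open import Data.Sum using (_⊎_; inj₁; inj₂)
open import Data.Empty using (⊥-elim)
open import Function using (id)
open import Data.List using (List; []; _∷_)
open import Data.List.Membership.Propositional using (_∈_)
open import Data.List.Relation.Unary.Any using (here; there)
open import Relation.Nullary using (¬_; yes; no)
open import Relation.Binary.PropositionalEquality
open import Algebra.Properties.CommutativeSemigroup +-commutativeSemigroup using (x∙yz≈y∙xz)

-- Codes of finite sets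

bit0≡0 : ∀ i → bit 0 i ≡ 0
bit0≡0 zero    = refl
bit0≡0 (suc i) = bit0≡0 i

bit≡iterate-half : ∀ u i → bit u i ≡ iterate (_/ 2) u i % 2
bit≡iterate-half u zero    = refl
bit≡iterate-half u (suc i) = bit≡iterate-half (u / 2) i

bit<2 : ∀ u i → bit u i < 2
bit<2 u i rewrite bit≡iterate-half u i = m%n<n (iterate (_/ 2) u i) 2

bit≢1⇒bit≡0 : ∀ u i → bit u i ≢ 1 → bit u i ≡ 0
bit≢1⇒bit≡0 u i bit≢1 with bit u i | bit<2 u i
... | zero        | _            = refl
... | suc zero    | _            = ⊥-elim (bit≢1 refl)
... | suc (suc _) | s≤s (s≤s ())

¬D0 : ∀ i → ¬ D 0 i
¬D0 i d = 0≢1+n (trans (sym (bit0≡0 i)) d)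

[m+n*2]%2≡m%2 : ∀ m n → (m + n * 2) % 2 ≡ m % 2
[m+n*2]%2≡m%2 m n = [m+kn]%n≡m%n m n 2

[m+n*2]/2≡m/2+n : ∀ m n → (m + n * 2) / 2 ≡ m / 2 + n
[m+n*2]/2≡m/2+n m n = trans (+-distrib-/-∣ʳ m (divides-refl n)) (cong (m / 2 +_) (m*n/n≡m n 2))

2^[1+n]≡2^n*2 : ∀ n → 2 ^ suc n ≡ 2 ^ n * 2
2^[1+n]≡2^n*2 n = *-comm 2 (2 ^ n)

even⇒m+1≡1+[m/2]*2 : ∀ m → m % 2 ≡ 0 → m + 1 ≡ 1 + m / 2 * 2
even⇒m+1≡1+[m/2]*2 m m%2≡0 = begin
  m + 1                   ≡⟨ +-comm m 1 ⟩
  1 + m                   ≡⟨ cong (1 +_) (m≡m%n+[m/n]*n m 2) ⟩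
  1 + (m % 2 + m / 2 * 2) ≡⟨ cong (λ r → 1 + (r + m / 2 * 2)) m%2≡0 ⟩
  1 + m / 2 * 2           ∎
  where open ≡-Reasoning

bit-+2^-same : ∀ e v → bit v e ≡ 0 → bit (v + 2 ^ e) e ≡ 1
bit-+2^-same zero v v₀≡0
  rewrite even⇒m+1≡1+[m/2]*2 v v₀≡0 = [m+n*2]%2≡m%2 1 (v / 2)
bit-+2^-same (suc e) v vₑ≡0
  rewrite 2^[1+n]≡2^n*2 e | [m+n*2]/2≡m/2+n v (2 ^ e) = bit-+2^-same e (v / 2) vₑ≡0

bit-+2^-other : ∀ e v i → bit v e ≡ 0 → i ≢ e → bit (v + 2 ^ e) i ≡ bit v i
bit-+2^-other zero    v zero    _    i≢e = ⊥-elim (i≢e refl)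
bit-+2^-other zero    v (suc i) v₀≡0 _
  rewrite even⇒m+1≡1+[m/2]*2 v v₀≡0 | [m+n*2]/2≡m/2+n 1 (v / 2) = refl
bit-+2^-other (suc e) v zero    _    _
  rewrite 2^[1+n]≡2^n*2 e = [m+n*2]%2≡m%2 v (2 ^ e)
bit-+2^-other (suc e) v (suc i) vₑ≡0 i≢e
  rewrite 2^[1+n]≡2^n*2 e | [m+n*2]/2≡m/2+n v (2 ^ e) =
  bit-+2^-other e (v / 2) i vₑ≡0 (λ i≡e → i≢e (cong suc i≡e))

D-2^-self : ∀ e → D (2 ^ e) e
D-2^-self e = bit-+2^-same e 0 (bit0≡0 e)

D-2^⇒≡ : ∀ {e i} → D (2 ^ e) i → i ≡ e
D-2^⇒≡ {e} {i} d with i ≟ e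
... | yes i≡e = i≡e
... | no  i≢e = ⊥-elim (¬D0 i (trans (sym (bit-+2^-other e 0 i (bit0≡0 e) i≢e)) d))

insert : ℕ → ℕ → ℕ
insert v e with bit v e ≟ 1
... | yes _ = v
... | no  _ = v + 2 ^ e

D-insert : ∀ v e i → D (insert v e) i ⇔ (i ≡ e ⊎ D v i)
D-insert v e i with bit v e ≟ 1
... | yes vₑ≡1 = inj₂ , λ { (inj₁ refl) → vₑ≡1 ; (inj₂ d) → d }
... | no  vₑ≢1 = to , from
  where
    vₑ≡0 : bit v e ≡ 0
    vₑ≡0 = bit≢1⇒bit≡0 v e vₑ≢1
    to : D (v + 2 ^ e) i → i ≡ e ⊎ D v i
    to d with i ≟ e
    ... | yes i≡e = inj₁ i≡e
    ... | no  i≢e = inj₂ (trans (sym (bit-+2^-other e v i vₑ≡0 i≢e)) d)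
    from : i ≡ e ⊎ D v i → D (v + 2 ^ e) i
    from (inj₁ refl) = bit-+2^-same e v vₑ≡0
    from (inj₂ d)    = trans (bit-+2^-other e v i vₑ≡0 (λ { refl → vₑ≢1 d })) d

code : List ℕ → ℕ
code []      = 0
code (e ∷ L) = insert (code L) e

D-code : ∀ L i → D (code L) i ⇔ (i ∈ L)
D-code []      i = (λ d → ⊥-elim (¬D0 i d)) , λ ()
D-code (e ∷ L) i = to , from
  where
    to : D (code (e ∷ L)) i → i ∈ e ∷ L
    to d with proj₁ (D-insert (code L) e i) d
    ... | inj₁ i≡e = here i≡e
    ... | inj₂ d′  = there (proj₁ (D-code L i) d′)
    from : i ∈ e ∷ L → D (code (e ∷ L)) i
    from (here i≡e)  = proj₂ (D-insert (code L) e i) (inj₁ i≡e)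
    from (there i∈L) = proj₂ (D-insert (code L) e i) (inj₂ (proj₂ (D-code L i) i∈L))

-- Primitive recursive functions

PrimRec : ∀ {n} → (Vec ℕ n → ℕ) → Set
PrimRec {n} F = Σ[ p ∈ PR n ] (∀ xs → eval p xs ≡ F xs)

PrimRec₁ : (ℕ → ℕ) → Set
PrimRec₁ f = ∀ {n} {A : Vec ℕ n → ℕ} → PrimRec A → PrimRec (λ xs → f (A xs))

PrimRec₂ : (ℕ → ℕ → ℕ) → Set
PrimRec₂ f = ∀ {n} {A B : Vec ℕ n → ℕ} → PrimRec A → PrimRec B → PrimRec (λ xs → f (A xs) (B xs))

PrimRec₃ : (ℕ → ℕ → ℕ → ℕ) → Set
PrimRec₃ f = ∀ {n} {A B C : Vec ℕ n → ℕ} →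
  PrimRec A → PrimRec B → PrimRec C → PrimRec (λ xs → f (A xs) (B xs) (C xs))

pr-cong : ∀ {n} {F G : Vec ℕ n → ℕ} → (∀ xs → F xs ≡ G xs) → PrimRec F → PrimRec G
pr-cong F≗G (p , p-ok) = p , λ xs → trans (p-ok xs) (F≗G xs)

pr-var : ∀ {n} (i : Fin n) → PrimRec (λ xs → lookup xs i)
pr-var i = proj i , λ _ → refl

pr-head : ∀ {n} → PrimRec {suc n} head
pr-head = proj fzero , λ { (_ ∷ _) → refl }

pr-const : ∀ {n} k → PrimRec {n} (λ _ → k)
pr-const zero    = zer , λ _ → refl
pr-const (suc k) = comp succ (proj₁ (pr-const k) ∷ []) , λ xs → cong suc (proj₂ (pr-const k) xs)

pr-suc : PrimRec₁ suc
pr-suc (a , a-ok) = comp succ (a ∷ []) , λ xs → cong suc (a-ok xs)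

pr-rec : ∀ {n} {F : ℕ → Vec ℕ n → ℕ} {H : Vec ℕ (suc (suc n)) → ℕ} →
  PrimRec (F 0) → PrimRec H → (∀ y xs → F (suc y) xs ≡ H (y ∷ F y xs ∷ xs)) →
  PrimRec (λ ys → F (head ys) (tail ys))
pr-rec {F = F} {H} (g , g-ok) (h , h-ok) F-suc = prec g h , ok
  where
    ok : ∀ ys → eval (prec g h) ys ≡ F (head ys) (tail ys)
    ok (zero  ∷ xs) = g-ok xs
    ok (suc y ∷ xs) = begin
      eval h (y ∷ eval (prec g h) (y ∷ xs) ∷ xs) ≡⟨ h-ok _ ⟩
      H (y ∷ eval (prec g h) (y ∷ xs) ∷ xs)      ≡⟨ cong (λ r → H (y ∷ r ∷ xs)) (ok (y ∷ xs)) ⟩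
      H (y ∷ F y xs ∷ xs)                        ≡⟨ F-suc y xs ⟨
      F (suc y) xs                               ∎
      where open ≡-Reasoning

pr₁ : ∀ {f} → PrimRec {1} (λ xs → f (head xs)) → PrimRec₁ f
pr₁ {f} (p , p-ok) (a , a-ok) = comp p (a ∷ []) , λ xs → trans (p-ok _) (cong f (a-ok xs))

pr₂ : ∀ {f} → PrimRec {2} (λ xs → f (head xs) (head (tail xs))) → PrimRec₂ f
pr₂ {f} (p , p-ok) (a , a-ok) (b , b-ok) =
  comp p (a ∷ b ∷ []) , λ xs → trans (p-ok _) (cong₂ f (a-ok xs) (b-ok xs))

pr₃ : ∀ {f} → PrimRec {3} (λ xs → f (head xs) (head (tail xs)) (head (tail (tail xs)))) → PrimRec₃ f
pr₃ {f} (p , p-ok) (a , a-ok) (b , b-ok) (c , c-ok) =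
  comp p (a ∷ b ∷ c ∷ []) , λ xs → trans (p-ok _)
    (trans (cong₂ (λ x y → f x y (eval c xs)) (a-ok xs) (b-ok xs)) (cong (f _ _) (c-ok xs)))

zeros-ce : ∀ {F : Vec ℕ 2 → ℕ} → PrimRec F → IsCE (λ z → Σ[ m ∈ ℕ ] F (z ∷ m ∷ []) ≡ 0)
zeros-ce (p , p-ok) = p , λ z →
  (λ (m , F≡0) → m , trans (p-ok _) F≡0) , (λ (m , p≡0) → m , trans (sym (p-ok _)) p≡0)

+-pr : PrimRec₂ _+_
+-pr = pr₂ {_+_} (pr-rec {F = λ y xs → y + head xs} pr-head (pr-suc (pr-var (fsuc fzero))) λ _ _ → refl)

pred-pr : PrimRec₁ pred
pred-pr = pr₁ {pred} (pr-rec {F = λ y _ → pred y} (pr-const 0) (pr-var fzero) λ _ _ → refl)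

∸-pr : PrimRec₂ _∸_
∸-pr a b = flipped b a
  where
    flipped : PrimRec₂ (λ y x → x ∸ y)
    flipped = pr₂ {λ y x → x ∸ y} (pr-rec {F = λ y xs → head xs ∸ y} pr-head (pred-pr (pr-var (fsuc fzero)))
      λ y xs → sym (pred[m∸n]≡m∸[1+n] (head xs) y))

∣-∣≡∸+∸ : ∀ m n → ∣ m - n ∣ ≡ (m ∸ n) + (n ∸ m)
∣-∣≡∸+∸ zero    n       = cong (_+ n) (sym (0∸n≡0 n))
∣-∣≡∸+∸ (suc m) zero    = sym (+-identityʳ (suc m))
∣-∣≡∸+∸ (suc m) (suc n) = ∣-∣≡∸+∸ m n

+≡0 : ∀ m {n} → m + n ≡ 0 → m ≡ 0 × n ≡ 0
+≡0 m m+n≡0 = m+n≡0⇒m≡0 m m+n≡0 , m+n≡0⇒n≡0 m m+n≡0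

∣-∣-pr : PrimRec₂ ∣_-_∣
∣-∣-pr {A = A} {B} a b = pr-cong (λ xs → sym (∣-∣≡∸+∸ (A xs) (B xs))) (+-pr (∸-pr a b) (∸-pr b a))

2^-pr : PrimRec₁ (2 ^_)
2^-pr = pr₁ {2 ^_} (pr-rec {F = λ e _ → 2 ^ e} (pr-const 1) (+-pr (pr-var (fsuc fzero)) (pr-var (fsuc fzero)))
  λ e _ → cong (2 ^ e +_) (+-identityʳ (2 ^ e)))

iterate-pr : ∀ {f} → PrimRec₁ f → PrimRec₂ (iterate f)
iterate-pr {f} f-pr {A = A} {I} a i = pr-cong (λ xs → iterate-is-fold (A xs) f (I xs)) (folded i a)
  where
    folded : PrimRec₂ (λ i x → fold x f i)
    folded = pr₂ {λ i x → fold x f i}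
      (pr-rec {F = λ i xs → fold (head xs) f i} pr-head (f-pr (pr-var (fsuc fzero))) λ _ _ → refl)

module FloorInverse (g : ℕ → ℕ) (g-0 : g 0 ≡ 0) (g-< : ∀ k → g k < g (suc k)) where

  -- The increment is the indicator of g (suc (inv z)) ≤ suc z, written arithmetically so that
  -- inv is visibly primitive recursive.
  inv : ℕ → ℕ
  inv zero    = zero
  inv (suc z) = inv z + (1 ∸ (g (suc (inv z)) ∸ suc z))

  g-mono : ∀ {a b} → a ≤ b → g a ≤ g b
  g-mono {a} a≤b = go (≤⇒≤′ a≤b)
    where
      go : ∀ {b} → a ≤′ b → g a ≤ g b
      go ≤′-refl     = ≤-refl
      go (≤′-step p) = ≤-trans (go p) (<⇒≤ (g-< _))

  inv-bracket : ∀ z → g (inv z) ≤ z × z < g (suc (inv z))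
  inv-bracket zero = ≤-reflexive g-0 , subst (_< g 1) g-0 (g-< 0)
  inv-bracket (suc z) with inv-bracket z | g (suc (inv z)) ≤? suc z
  ... | _ , z<g | yes reached
    rewrite m≤n⇒m∸n≡0 reached | +-comm (inv z) 1 =
    reached , subst (_< g (suc (suc (inv z)))) (≤-antisym reached z<g) (g-< (suc (inv z)))
  ... | g≤z , _ | no unreached
    rewrite m≤n⇒m∸n≡0 (m<n⇒0<n∸m (≰⇒> unreached)) | +-identityʳ (inv z) =
    m≤n⇒m≤1+n g≤z , ≰⇒> unreached

  inv-unique : ∀ {z d} → g d ≤ z → z < g (suc d) → inv z ≡ d
  inv-unique {z} {d} lo hi = ≤-antisym
    (≮⇒≥ λ d<inv → <⇒≱ hi (≤-trans (g-mono d<inv) (proj₁ (inv-bracket z))))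
    (≮⇒≥ λ inv<d → <⇒≱ (proj₂ (inv-bracket z)) (≤-trans (g-mono inv<d) lo))

  inv-pr : PrimRec₁ g → PrimRec₁ inv
  inv-pr g-pr = pr₁ {inv} (pr-rec {F = λ z _ → inv z} (pr-const 0)
    (+-pr r (∸-pr (pr-const 1) (∸-pr (g-pr (pr-suc r)) (pr-suc (pr-var fzero))))) λ _ _ → refl)
    where
      r : PrimRec {2} (λ xs → lookup xs (fsuc fzero))
      r = pr-var (fsuc fzero)

-- Cantor pairing

tri-< : ∀ k → tri k < tri (suc k)
tri-< k = s≤s (m≤n+m (tri k) k)

module Diagonal = FloorInverse tri refl tri-<

π₂ : ℕ → ℕ
π₂ z = z ∸ tri (Diagonal.inv z)

π₁ : ℕ → ℕ
π₁ z = Diagonal.inv z ∸ π₂ z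

diagonal-pair : ∀ x y → Diagonal.inv ⟪ x ∣ y ⟫ ≡ x + y
diagonal-pair x y = Diagonal.inv-unique (m≤m+n (tri (x + y)) y) y<
  where
    y< : tri (x + y) + y < suc (x + y) + tri (x + y)
    y< rewrite +-comm (suc (x + y)) (tri (x + y)) = +-monoʳ-< (tri (x + y)) (s≤s (m≤n+m y x))

π₂-pair : ∀ x y → π₂ ⟪ x ∣ y ⟫ ≡ y
π₂-pair x y rewrite diagonal-pair x y = m+n∸m≡n (tri (x + y)) y

π₁-pair : ∀ x y → π₁ ⟪ x ∣ y ⟫ ≡ x
π₁-pair x y rewrite π₂-pair x y | diagonal-pair x y = m+n∸n≡m x y

pair-π : ∀ z → ⟪ π₁ z ∣ π₂ z ⟫ ≡ z
pair-π z = begin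
  tri (π₁ z + π₂ z) + π₂ z ≡⟨ cong (λ e → tri e + π₂ z) (m∸n+n≡m π₂≤d) ⟩
  tri d + π₂ z             ≡⟨ m+[n∸m]≡n lo ⟩
  z                        ∎
  where
    open ≡-Reasoning
    d : ℕ
    d = Diagonal.inv z
    lo : tri d ≤ z
    lo = proj₁ (Diagonal.inv-bracket z)
    π₂≤d : π₂ z ≤ d
    π₂≤d = m≤n+o⇒m∸n≤o z (tri d) (subst (z ≤_) (+-comm d (tri d)) (s≤s⁻¹ (proj₂ (Diagonal.inv-bracket z))))

pair-injective : ∀ {x y x′ y′} → ⟪ x ∣ y ⟫ ≡ ⟪ x′ ∣ y′ ⟫ → x ≡ x′ × y ≡ y′
pair-injective {x} {y} {x′} {y′} eq =
  trans (sym (π₁-pair x y)) (trans (cong π₁ eq) (π₁-pair x′ y′)) ,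
  trans (sym (π₂-pair x y)) (trans (cong π₂ eq) (π₂-pair x′ y′))

pair-π₁ : ∀ z {v} → π₂ z ≡ v → z ≡ ⟪ π₁ z ∣ v ⟫
pair-π₁ z refl = sym (pair-π z)

2^⟪m∣1⟫≢1 : ∀ m → 2 ^ ⟪ m ∣ 1 ⟫ ≢ 1
2^⟪m∣1⟫≢1 m eq = <⇒≱ (s≤s (s≤s z≤n)) (subst (2 ≤_) eq (^-monoʳ-≤ 2 (m≤n+m 1 (tri (m + 1)))))

tri-pr : PrimRec₁ tri
tri-pr = pr₁ {tri} (pr-rec {F = λ n _ → tri n} (pr-const 0)
  (+-pr (pr-suc (pr-var fzero)) (pr-var (fsuc fzero))) λ _ _ → refl)

pair-pr : PrimRec₂ ⟪_∣_⟫
pair-pr a b = +-pr (tri-pr (+-pr a b)) b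

π₂-pr : PrimRec₁ π₂
π₂-pr a = ∸-pr a (tri-pr (Diagonal.inv-pr tri-pr a))

π₁-pr : PrimRec₁ π₁
π₁-pr a = ∸-pr (Diagonal.inv-pr tri-pr a) (π₂-pr a)

-- Binary digits and logarithm

module Halving = FloorInverse (λ k → k + k) refl (λ k → +-mono-< (n<1+n k) (n<1+n k))

n*2≡n+n : ∀ n → n * 2 ≡ n + n
n*2≡n+n n = trans (*-comm n 2) (cong (n +_) (+-identityʳ n))

halving≡/2 : ∀ z → Halving.inv z ≡ z / 2
halving≡/2 z = Halving.inv-unique
  (subst (_≤ z) (n*2≡n+n (z / 2)) (m/n*n≤m z 2))
  (subst₂ _<_ (sym (m≡m%n+[m/n]*n z 2)) (n*2≡n+n (suc (z / 2))) (+-monoˡ-< (z / 2 * 2) (m%n<n z 2)))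

/2-pr : PrimRec₁ (_/ 2)
/2-pr {A = A} a = pr-cong (λ xs → halving≡/2 (A xs)) (Halving.inv-pr (λ b → +-pr b b) a)

%2-pr : PrimRec₁ (_% 2)
%2-pr {A = A} a = pr-cong (λ xs → sym (m%2≡m∸[m/2+m/2] (A xs))) (∸-pr a (+-pr (/2-pr a) (/2-pr a)))
  where
    m%2≡m∸[m/2+m/2] : ∀ m → m % 2 ≡ m ∸ (m / 2 + m / 2)
    m%2≡m∸[m/2+m/2] m = trans (m%n≡m∸m/n*n m 2) (cong (m ∸_) (n*2≡n+n (m / 2)))

bit-pr : PrimRec₂ bit
bit-pr {A = U} {I} u i = pr-cong (λ xs → sym (bit≡iterate-half (U xs) (I xs))) (%2-pr (iterate-pr /2-pr u i))

absent : ℕ → ℕ → ℕ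
absent w f = 1 ∸ bit w f

absent-pr : PrimRec₂ absent
absent-pr w f = ∸-pr (pr-const 1) (bit-pr w f)

absent≡0⇒D : ∀ w f → absent w f ≡ 0 → D w f
absent≡0⇒D w f absent≡0 = ≤-antisym (s≤s⁻¹ (bit<2 w f)) (m∸n≡0⇒m≤n absent≡0)

D⇒absent≡0 : ∀ w f → D w f → absent w f ≡ 0
D⇒absent≡0 w f d = cong (1 ∸_) d

2^n∸1<2^[1+n]∸1 : ∀ n → 2 ^ n ∸ 1 < 2 ^ suc n ∸ 1
2^n∸1<2^[1+n]∸1 n = ∸-monoˡ-< (^-monoʳ-< 2 (s≤s (s≤s z≤n)) (n<1+n n)) (m^n>0 2 n)

module Log₂ = FloorInverse (λ k → 2 ^ k ∸ 1) refl 2^n∸1<2^[1+n]∸1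

log₂ : ℕ → ℕ
log₂ u = Log₂.inv (u ∸ 1)

log₂-2^ : ∀ e → log₂ (2 ^ e) ≡ e
log₂-2^ e = Log₂.inv-unique ≤-refl (2^n∸1<2^[1+n]∸1 e)

log₂-pr : PrimRec₁ log₂
log₂-pr a = Log₂.inv-pr (λ b → ∸-pr (2^-pr b) (pr-const 1)) (∸-pr a (pr-const 1))

-- The embedding

module Embedding (𝒜 : PCA) (γ : PartialNumbering 𝒜) where
  open PCA 𝒜
  open PartialNumbering γ

  index : Carrier → ℕ
  index a = proj₁ (surjective a)

  index-num : ∀ a → Num (index a) a
  index-num a = proj₂ (surjective a)

  κ : ℕ
  κ = index k

  X : Subset
  X = graphSet 𝒜 γ

  Applies : ℕ → ℕ → ℕ → Set
  Applies n m q = Σ[ a ∈ Carrier ] Σ[ b ∈ Carrier ] Σ[ c ∈ Carrier ] Num n a × Num m b × Num q c × App a b c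

  X-triple : ∀ n m q → X ⟪ n ∣ m ∣ q ⟫ ⇔ Applies n m q
  X-triple n m q = to , λ applies → n , m , q , refl , applies
    where
      to : X ⟪ n ∣ m ∣ q ⟫ → Applies n m q
      to (n′ , m′ , q′ , eq , applies)
        with pair-injective {n} {⟪ m ∣ q ⟫} {n′} {⟪ m′ ∣ q′ ⟫} eq
      ... | refl , eq′ with pair-injective {m} {q} {m′} {q′} eq′
      ... | refl , refl = applies

  Applies⇒App : ∀ {n m q c} → Num n c → Applies n m q →
    Σ[ b ∈ Carrier ] Σ[ c′ ∈ Carrier ] Num m b × Num q c′ × App c b c′
  Applies⇒App nc (a , b , c′ , na , mb , qc′ , abc′) with functional nc na
  ... | refl = b , c′ , mb , qc′ , abc′

  Num-via-k : ∀ {t n c} → Num n c → Num t c ⇔ (Σ[ j ∈ ℕ ] Applies κ t j × Applies j κ n)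
  Num-via-k {t} {n} {c} nc = to , from
    where
      to : Num t c → Σ[ j ∈ ℕ ] Applies κ t j × Applies j κ n
      to tc with k-ax c k
      ... | x , kcx , xkc = index x , (k , c , x , index-num k , tc , index-num x , kcx)
                                    , (x , k , c , index-num x , index-num k , nc , xkc)
      from : Σ[ j ∈ ℕ ] Applies κ t j × Applies j κ n → Num t c
      from (j , (k₁ , a , x , κk₁ , ta , jx , k₁ax) , (x′ , k₂ , c′ , jx′ , κk₂ , nc′ , x′k₂c′))
        with functional (index-num k) κk₁ | functional jx jx′ | functional (index-num k) κk₂ | functional nc nc′
      ... | refl | refl | refl | refl with k-ax a k
      ... | x₀ , kax₀ , x₀ka with App-functional k₁ax kax₀
      ... | refl with App-functional x′k₂c′ x₀ka
      ... | refl = ta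

  -- The padding p of a tag is where a step stores the index q of c·b.
  data ⟦_⟧ : Carrier → ℕ → Set where
    tag  : ∀ {c t p y} → Num t c → y ≡ ⟪ ⟪ t ∣ p ⟫ ∣ 1 ⟫ → ⟦ c ⟧ y
    step : ∀ {c b c′ m q x y} → App c b c′ → Num m b → Num q c′ → ⟦ c′ ⟧ x →
           y ≡ ⟪ x ∣ 2 ^ ⟪ ⟪ m ∣ q ⟫ ∣ 1 ⟫ ⟫ → ⟦ c ⟧ y

  tag-num : ∀ {b m p} → ⟦ b ⟧ ⟪ ⟪ m ∣ p ⟫ ∣ 1 ⟫ → Num m b
  tag-num {m = m} {p} (tag {t = t} {p′} tb eq)
    with pair-injective {⟪ m ∣ p ⟫} {1} {⟪ t ∣ p′ ⟫} {1} eq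
  ... | eq′ , _ with pair-injective {m} {p} {t} {p′} eq′
  ... | refl , _ = tb
  tag-num {m = m} {p} (step {m = m′} {q} {x} _ _ _ _ eq) = ⊥-elim (2^⟪m∣1⟫≢1 ⟪ m′ ∣ q ⟫ (sym 1≡2^e))
    where
      1≡2^e : 1 ≡ 2 ^ ⟪ ⟪ m′ ∣ q ⟫ ∣ 1 ⟫
      1≡2^e = proj₂ (pair-injective {⟪ m ∣ p ⟫} {1} {x} {2 ^ ⟪ ⟪ m′ ∣ q ⟫ ∣ 1 ⟫} eq)

  0∉⟦_⟧ : ∀ b → ¬ ⟦ b ⟧ 0
  0∉⟦ b ⟧ (tag {t = t} {p} _ eq) with trans (cong π₂ eq) (π₂-pair ⟪ t ∣ p ⟫ 1)
  ... | ()
  0∉⟦ b ⟧ (step {m = m} {q} {x} _ _ _ _ eq) =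
    <⇒≢ (m^n>0 2 ⟪ ⟪ m ∣ q ⟫ ∣ 1 ⟫) (trans (cong π₂ eq) (π₂-pair x (2 ^ ⟪ ⟪ m ∣ q ⟫ ∣ 1 ⟫)))

  hom : ∀ {a b c} → App a b c → (⟦ a ⟧ · ⟦ b ⟧) ≐ ⟦ c ⟧
  hom {a} {b} {c} abc x = to , from
    where
      to : (⟦ a ⟧ · ⟦ b ⟧) x → ⟦ c ⟧ x
      -- A tag has u = 1, and 0 ∈ D 1 belongs to no ⟦ b ⟧.
      to (u , tag {t = t} {p} _ eq , D⊆⟦b⟧)
        with pair-injective {x} {u} {⟪ t ∣ p ⟫} {1} eq
      ... | _ , refl = ⊥-elim (0∉⟦ b ⟧ (D⊆⟦b⟧ 0 refl))
      to (u , step {b = b′} {m = m} {q} {x′} ab′c′ mb′ _ x∈c′ eq , D⊆⟦b⟧)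
        with pair-injective {x} {u} {x′} {2 ^ ⟪ ⟪ m ∣ q ⟫ ∣ 1 ⟫} eq
      ... | refl , refl with functional mb′ (tag-num {p = q} (D⊆⟦b⟧ _ (D-2^-self ⟪ ⟪ m ∣ q ⟫ ∣ 1 ⟫)))
      ... | refl with App-functional abc ab′c′
      ... | refl = x∈c′
      tagᵇ : ℕ
      tagᵇ = ⟪ ⟪ index b ∣ index c ⟫ ∣ 1 ⟫
      from : ⟦ c ⟧ x → (⟦ a ⟧ · ⟦ b ⟧) x
      from x∈c = 2 ^ tagᵇ , step abc (index-num b) (index-num c) x∈c refl ,
        λ i d → subst ⟦ b ⟧ (sym (D-2^⇒≡ d)) (tag (index-num b) refl)

  injective : ∀ {a b} → ⟦ a ⟧ ≐ ⟦ b ⟧ → a ≡ b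
  injective {a} ⟦a⟧≐⟦b⟧ =
    functional (index-num a) (tag-num (proj₁ (⟦a⟧≐⟦b⟧ ⟪ ⟪ index a ∣ 0 ⟫ ∣ 1 ⟫) (tag (index-num a) refl)))

  -- A claim s = ⟪ y ∣ n ⟫ asserts y ∈ ⟦ γ n ⟧; defect i j s w is 0 iff s is established by i steps
  -- and a tag checked through the k-witness j, using only application facts in D w.
  tagIndex exponent argIndex resultIndex next : ℕ → ℕ
  tagIndex s    = π₁ (π₁ (π₁ s))
  exponent s    = log₂ (π₂ (π₁ s))
  argIndex s    = π₁ (π₁ (exponent s))
  resultIndex s = π₂ (π₁ (exponent s))
  next s        = ⟪ π₁ (π₁ s) ∣ resultIndex s ⟫

  tagDefect : ℕ → ℕ → ℕ → ℕ
  tagDefect j s w = ∣ π₂ (π₁ s) - 1 ∣ + absent w ⟪ κ ∣ tagIndex s ∣ j ⟫ + absent w ⟪ j ∣ κ ∣ π₂ s ⟫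

  stepDefect : ℕ → ℕ → ℕ
  stepDefect s w = ∣ π₂ (π₁ s) - 2 ^ exponent s ∣ + ∣ π₂ (exponent s) - 1 ∣
                 + absent w ⟪ π₂ s ∣ argIndex s ∣ resultIndex s ⟫

  defect : ℕ → ℕ → ℕ → ℕ → ℕ
  defect zero    j s w = tagDefect j s w
  defect (suc i) j s w = stepDefect s w + defect i j (next s) w

  tagDefect-tag : ∀ j t p n w →
    tagDefect j ⟪ ⟪ ⟪ t ∣ p ⟫ ∣ 1 ⟫ ∣ n ⟫ w ≡ absent w ⟪ κ ∣ t ∣ j ⟫ + absent w ⟪ j ∣ κ ∣ n ⟫
  tagDefect-tag j t p n w
    rewrite π₁-pair ⟪ ⟪ t ∣ p ⟫ ∣ 1 ⟫ n | π₂-pair ⟪ ⟪ t ∣ p ⟫ ∣ 1 ⟫ n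
          | π₁-pair ⟪ t ∣ p ⟫ 1 | π₂-pair ⟪ t ∣ p ⟫ 1 | π₁-pair t p = refl

  exponent-step : ∀ x e n → exponent ⟪ ⟪ x ∣ 2 ^ e ⟫ ∣ n ⟫ ≡ e
  exponent-step x e n rewrite π₁-pair ⟪ x ∣ 2 ^ e ⟫ n | π₂-pair x (2 ^ e) = log₂-2^ e

  stepDefect-step : ∀ x m q n w →
    stepDefect ⟪ ⟪ x ∣ 2 ^ ⟪ ⟪ m ∣ q ⟫ ∣ 1 ⟫ ⟫ ∣ n ⟫ w ≡ absent w ⟪ n ∣ m ∣ q ⟫
  stepDefect-step x m q n w
    rewrite exponent-step x ⟪ ⟪ m ∣ q ⟫ ∣ 1 ⟫ n
          | π₁-pair ⟪ x ∣ 2 ^ ⟪ ⟪ m ∣ q ⟫ ∣ 1 ⟫ ⟫ n | π₂-pair ⟪ x ∣ 2 ^ ⟪ ⟪ m ∣ q ⟫ ∣ 1 ⟫ ⟫ n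
          | π₂-pair x (2 ^ ⟪ ⟪ m ∣ q ⟫ ∣ 1 ⟫) | ∣n-n∣≡0 (2 ^ ⟪ ⟪ m ∣ q ⟫ ∣ 1 ⟫)
          | π₁-pair ⟪ m ∣ q ⟫ 1 | π₂-pair ⟪ m ∣ q ⟫ 1 | π₁-pair m q | π₂-pair m q = refl

  next-step : ∀ x m q n → next ⟪ ⟪ x ∣ 2 ^ ⟪ ⟪ m ∣ q ⟫ ∣ 1 ⟫ ⟫ ∣ n ⟫ ≡ ⟪ x ∣ q ⟫
  next-step x m q n
    rewrite exponent-step x ⟪ ⟪ m ∣ q ⟫ ∣ 1 ⟫ n | π₁-pair ⟪ x ∣ 2 ^ ⟪ ⟪ m ∣ q ⟫ ∣ 1 ⟫ ⟫ n
          | π₁-pair x (2 ^ ⟪ ⟪ m ∣ q ⟫ ∣ 1 ⟫) | π₁-pair ⟪ m ∣ q ⟫ 1 | π₂-pair m q = refl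

  tagDefect≡0 : ∀ j s w → tagDefect j s w ≡ 0 →
    π₁ s ≡ ⟪ ⟪ tagIndex s ∣ π₂ (π₁ (π₁ s)) ⟫ ∣ 1 ⟫ × D w ⟪ κ ∣ tagIndex s ∣ j ⟫ × D w ⟪ j ∣ κ ∣ π₂ s ⟫
  tagDefect≡0 j s w tag≡0 =
    let (AB≡0 , C≡0) = +≡0 _ tag≡0
        (A≡0 , B≡0)  = +≡0 _ AB≡0
    in trans (pair-π₁ (π₁ s) (∣m-n∣≡0⇒m≡n A≡0)) (cong ⟪_∣ 1 ⟫ (sym (pair-π (π₁ (π₁ s))))) ,
       absent≡0⇒D w ⟪ κ ∣ tagIndex s ∣ j ⟫ B≡0 , absent≡0⇒D w ⟪ j ∣ κ ∣ π₂ s ⟫ C≡0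

  stepDefect≡0 : ∀ s w → stepDefect s w ≡ 0 →
    π₁ s ≡ ⟪ π₁ (π₁ s) ∣ 2 ^ ⟪ ⟪ argIndex s ∣ resultIndex s ⟫ ∣ 1 ⟫ ⟫ × D w ⟪ π₂ s ∣ argIndex s ∣ resultIndex s ⟫
  stepDefect≡0 s w step≡0 =
    let (AB≡0 , C≡0) = +≡0 _ step≡0
        (A≡0 , B≡0)  = +≡0 _ AB≡0
        exponent≡ = trans (pair-π₁ (exponent s) (∣m-n∣≡0⇒m≡n B≡0)) (cong ⟪_∣ 1 ⟫ (sym (pair-π (π₁ (exponent s)))))
    in trans (pair-π₁ (π₁ s) (∣m-n∣≡0⇒m≡n A≡0)) (cong (λ e → ⟪ π₁ (π₁ s) ∣ 2 ^ e ⟫) exponent≡) ,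
       absent≡0⇒D w ⟪ π₂ s ∣ argIndex s ∣ resultIndex s ⟫ C≡0

  sound : ∀ i j s w → defect i j s w ≡ 0 → (∀ f → D w f → X f) → ∀ {c} → Num (π₂ s) c → ⟦ c ⟧ (π₁ s)
  sound zero j s w accepted D⊆X nc =
    let (π₁s≡ , κtj , jκn) = tagDefect≡0 j s w accepted
        fact : ∀ n m q → D w ⟪ n ∣ m ∣ q ⟫ → Applies n m q
        fact n m q d = proj₁ (X-triple n m q) (D⊆X _ d)
    in tag {t = tagIndex s} {p = π₂ (π₁ (π₁ s))}
           (proj₂ (Num-via-k nc) (j , fact κ (tagIndex s) j κtj , fact j κ (π₂ s) jκn)) π₁s≡
  sound (suc i) j s w accepted D⊆X nc =
    let (step≡0 , rest≡0)           = +≡0 (stepDefect s w) accepted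
        (π₁s≡ , nmq)                = stepDefect≡0 s w step≡0
        (b , c′ , mb , qc′ , cbc′)  = Applies⇒App nc (proj₁ (X-triple (π₂ s) (argIndex s) (resultIndex s)) (D⊆X _ nmq))
        x∈c′ = sound i j (next s) w rest≡0 D⊆X (subst (λ n → Num n c′) (sym (π₂-pair (π₁ (π₁ s)) (resultIndex s))) qc′)
    in step cbc′ mb qc′ (subst ⟦ c′ ⟧ (π₁-pair (π₁ (π₁ s)) (resultIndex s)) x∈c′) π₁s≡

  record Certificate (y n : ℕ) : Set where
    field
      length witness : ℕ
      facts          : List ℕ
      facts⊆X        : ∀ f → f ∈ facts → X f
      accepted       : ∀ w → (∀ f → f ∈ facts → D w f) → defect length witness ⟪ y ∣ n ⟫ w ≡ 0

  complete : ∀ {c y n} → ⟦ c ⟧ y → Num n c → Certificate y n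
  complete {n = n} (tag {t = t} {p} tc refl) nc =
    let (j , κtj , jκn) = proj₁ (Num-via-k nc) tc
        fact₁ = ⟪ κ ∣ t ∣ j ⟫
        fact₂ = ⟪ j ∣ κ ∣ n ⟫
    in record
      { length   = 0
      ; witness  = j
      ; facts    = fact₁ ∷ fact₂ ∷ []
      ; facts⊆X  = λ { _ (here refl) → proj₂ (X-triple κ t j) κtj
                     ; _ (there (here refl)) → proj₂ (X-triple j κ n) jκn }
      ; accepted = λ w facts⊆D → trans (tagDefect-tag j t p n w)
          (cong₂ _+_ (D⇒absent≡0 w fact₁ (facts⊆D fact₁ (here refl)))
                     (D⇒absent≡0 w fact₂ (facts⊆D fact₂ (there (here refl)))))
      }
  complete {n = n} (step {m = m} {q} {x} cbc′ mb qc′ x∈c′ refl) nc = record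
    { length   = suc length
    ; witness  = witness
    ; facts    = fact ∷ facts
    ; facts⊆X  = λ { _ (here refl) → proj₂ (X-triple n m q) (_ , _ , _ , nc , mb , qc′ , cbc′)
                   ; f (there f∈facts) → facts⊆X f f∈facts }
    ; accepted = λ w facts⊆D → cong₂ _+_
        (trans (stepDefect-step x m q n w) (D⇒absent≡0 w fact (facts⊆D fact (here refl))))
        (trans (cong (λ s → defect length witness s w) (next-step x m q n))
               (accepted w λ f f∈facts → facts⊆D f (there f∈facts)))
    }
    where
      open Certificate (complete x∈c′ qc′)
      fact : ℕ
      fact = ⟪ n ∣ m ∣ q ⟫

  -- defect recurses on a changing claim; its closed form below is an ordinary primitive recursion.
  stepDefects : ℕ → ℕ → ℕ → ℕ
  stepDefects zero    s w = 0
  stepDefects (suc i) s w = stepDefects i s w + stepDefect (iterate next s i) w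

  stepDefects-suc : ∀ i s w → stepDefects (suc i) s w ≡ stepDefect s w + stepDefects i (next s) w
  stepDefects-suc zero    s w = sym (+-identityʳ (stepDefect s w))
  stepDefects-suc (suc i) s w = trans
    (cong (_+ stepDefect (iterate next s (suc i)) w) (stepDefects-suc i s w))
    (+-assoc (stepDefect s w) (stepDefects i (next s) w) (stepDefect (iterate next (next s) i) w))

  defect≡tagDefect+stepDefects : ∀ i j s w → defect i j s w ≡ tagDefect j (iterate next s i) w + stepDefects i s w
  defect≡tagDefect+stepDefects zero    j s w = sym (+-identityʳ (tagDefect j s w))
  defect≡tagDefect+stepDefects (suc i) j s w = begin
    stepDefect s w + defect i j (next s) w
      ≡⟨ cong (stepDefect s w +_) (defect≡tagDefect+stepDefects i j (next s) w) ⟩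
    stepDefect s w + (tagDefect j sᵢ w + stepDefects i (next s) w)
      ≡⟨ x∙yz≈y∙xz (stepDefect s w) (tagDefect j sᵢ w) (stepDefects i (next s) w) ⟩
    tagDefect j sᵢ w + (stepDefect s w + stepDefects i (next s) w)
      ≡⟨ cong (tagDefect j sᵢ w +_) (stepDefects-suc i s w) ⟨
    tagDefect j sᵢ w + stepDefects (suc i) s w
      ∎
    where
      open ≡-Reasoning
      sᵢ : ℕ
      sᵢ = iterate next (next s) i

  exponent-pr : PrimRec₁ exponent
  exponent-pr s = log₂-pr (π₂-pr (π₁-pr s))

  resultIndex-pr : PrimRec₁ resultIndex
  resultIndex-pr s = π₂-pr (π₁-pr (exponent-pr s))

  next-pr : PrimRec₁ next
  next-pr s = pair-pr (π₁-pr (π₁-pr s)) (resultIndex-pr s)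

  tagDefect-pr : PrimRec₃ tagDefect
  tagDefect-pr j s w =
    +-pr (+-pr (∣-∣-pr (π₂-pr (π₁-pr s)) (pr-const 1))
               (absent-pr w (pair-pr (pr-const κ) (pair-pr (π₁-pr (π₁-pr (π₁-pr s))) j))))
         (absent-pr w (pair-pr j (pair-pr (pr-const κ) (π₂-pr s))))

  stepDefect-pr : PrimRec₂ stepDefect
  stepDefect-pr s w =
    +-pr (+-pr (∣-∣-pr (π₂-pr (π₁-pr s)) (2^-pr (exponent-pr s)))
               (∣-∣-pr (π₂-pr (exponent-pr s)) (pr-const 1)))
         (absent-pr w (pair-pr (π₂-pr s) (pair-pr (π₁-pr (π₁-pr (exponent-pr s))) (resultIndex-pr s))))

  stepDefects-pr : PrimRec₃ stepDefects
  stepDefects-pr = pr₃ {stepDefects}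
    (pr-rec {F = λ i xs → stepDefects i (head xs) (head (tail xs))} (pr-const 0)
      (+-pr (pr-var (fsuc fzero))
            (stepDefect-pr (iterate-pr next-pr (pr-var (fsuc (fsuc fzero))) (pr-var fzero))
                           (pr-var (fsuc (fsuc (fsuc fzero))))))
      λ { _ (_ ∷ _ ∷ []) → refl })

  defect-pr : ∀ {n} {I J S W : Vec ℕ n → ℕ} → PrimRec I → PrimRec J → PrimRec S → PrimRec W →
    PrimRec (λ xs → defect (I xs) (J xs) (S xs) (W xs))
  defect-pr {I = I} {J} {S} {W} i j s w =
    pr-cong (λ xs → sym (defect≡tagDefect+stepDefects (I xs) (J xs) (S xs) (W xs)))
      (+-pr (tagDefect-pr j (iterate-pr next-pr s i) w) (stepDefects-pr i s w))

  Accepts : ℕ → Subset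
  Accepts n z = Σ[ m ∈ ℕ ] defect (π₁ m) (π₂ m) ⟪ π₁ z ∣ n ⟫ (π₂ z) ≡ 0

  Accepts-ce : ∀ n → IsCE (Accepts n)
  Accepts-ce n = zeros-ce (defect-pr (π₁-pr m) (π₂-pr m) (pair-pr (π₁-pr z) (pr-const n)) (π₂-pr z))
    where
      z : PrimRec {2} (λ xs → lookup xs fzero)
      z = pr-var fzero
      m : PrimRec {2} (λ xs → lookup xs (fsuc fzero))
      m = pr-var (fsuc fzero)

  ⟦⟧≐Accepts·X : ∀ c → ⟦ c ⟧ ≐ (Accepts (index c) · X)
  ⟦⟧≐Accepts·X c y = to , from
    where
      n : ℕ
      n = index c
      to : ⟦ c ⟧ y → (Accepts n · X) y
      to y∈c = code facts , (⟪ length ∣ witness ⟫ , accepted′) , λ f d → facts⊆X f (proj₁ (D-code facts f) d)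
        where
          open Certificate (complete y∈c (index-num c))
          accepted′ : defect (π₁ ⟪ length ∣ witness ⟫) (π₂ ⟪ length ∣ witness ⟫)
                             ⟪ π₁ ⟪ y ∣ code facts ⟫ ∣ n ⟫ (π₂ ⟪ y ∣ code facts ⟫) ≡ 0
          accepted′ rewrite π₁-pair length witness | π₂-pair length witness
                          | π₁-pair y (code facts) | π₂-pair y (code facts) =
            accepted (code facts) λ f → proj₂ (D-code facts f)
      from : (Accepts n · X) y → ⟦ c ⟧ y
      from (w , (m , accepted) , D⊆X) rewrite π₁-pair y w | π₂-pair y w =
        subst ⟦ c ⟧ (π₁-pair y n)
          (sound (π₁ m) (π₂ m) ⟪ y ∣ n ⟫ w accepted D⊆X (subst (λ n′ → Num n′ c) (sym (π₂-pair y n)) (index-num c)))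

  embedding : EmbeddingInto 𝒜 (InG^ X)
  embedding = record
    { f         = ⟦_⟧
    ; injective = injective
    ; hom       = hom
    ; inClass   = λ c → app (ce (Accepts-ce (index c))) (base λ _ → id , id) (⟦⟧≐Accepts·X c)
    }

forget-class : ∀ {𝒜 Cls} → EmbeddingInto 𝒜 Cls → EmbeddingInto 𝒜 AnySet
forget-class e = record { f = f ; injective = injective ; hom = hom ; inClass = λ _ → _ }
  where open EmbeddingInto e

theorem7p1 : (𝒜 : PCA) (γ : PartialNumbering 𝒜) →
    EmbeddingInto 𝒜 (InG^ (graphSet 𝒜 γ)) × EmbeddingInto 𝒜 AnySet
theorem7p1 𝒜 γ = embedding , forget-class embedding
  where open Embedding 𝒜 γ using (embedding)
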